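{- Let $p$ be any pattern in the symmetry class of one of the following 24 patterns: $(123,\{0\},\{0,1,2\})$, $(123,\{0\},\{0,1,3\})$, $(123,\{0\},\{0,2,3\})$, $(123,\{0\},\{1,2,3\})$, $(123,\{1\},\{0,1,2\})$, $(123,\{1\},\{0,1,3\})$, $(123,\{1\},\{0,2,3\})$, $(123,\{1\},\{1,2,3\})$, $(132,\{0\},\{0,1,2\})$, $(132,\{0\},\{0,1,3\})$, $(132,\{0\},\{0,2,3\})$, $(132,\{0\},\{1,2,3\})$, $(132,\{1\},\{0,1,2\})$, $(132,\{1\},\{0,1,3\})$, $(132,\{1\},\{0,2,3\})$, $(132,\{1\},\{1,2,3\})$, $(132,\{2\},\{0,1,2\})$, $(132,\{2\},\{0,1,3\})$, $(132,\{2\},\{0,2,3\})$, $(132,\{2\},\{1,2,3\})$, $(132,\{0,1,2\},\{3\})$, $(132,\{3\},\{0,1,3\})$, $(132,\{3\},\{0,2,3\})$, $(132,\{3\},\{1,2,3\})$. Then for all $n\ge3$, $a_n(p)=n!-\frac{(n-1)!}{2}$.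
   Context: A bi-vincular pattern of length $k$ is a triple $p=(\sigma,X,Y)$ with $\sigma$ a permutation of $[k]$ in one-line notation and $X,Y\subseteq\{0,1,\dots,k\}$. A permutation $\pi=\pi_1\cdots\pi_n$ of $[n]$ contains $p$ if there are indices $1\le i_1<\dots<i_k\le n$ such that $(\pi_{i_1},\dots,\pi_{i_k})$ is order-isomorphic to $\sigma$ and, writing $j_1<\dots<j_k$ for the set $\{\pi_{i_1},\dots,\pi_{i_k}\}$ in increasing order and setting $i_0=j_0=0$, $i_{k+1}=j_{k+1}=n+1$, we have $i_{x+1}=i_x+1$ for all $x\in X$ and $j_{y+1}=j_y+1$ for all $y\in Y$. Otherwise $\pi$ avoids $p$; $a_n(p)$ is the number of permutations of $[n]$ avoiding $p$. For $p=(\sigma,X,Y)$ of length $k$ define $p^{i}=(\sigma^{ -1},Y,X)$, $p^{r}=(\sigma^{r},\{k-x:x\in X\},Y)$, $p^{c}=(\sigma^{c},X,\{k-y:y\in Y\})$, with $\sigma^r_m=\sigma_{k+1-m}$ and $\sigma^c_m=k+1-\sigma_m$; the symmetry class of $p$ is the set of patterns obtained from $p$ by finite compositions of $i,r,c$. -}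

module Defs where

open import Data.Nat using (ℕ; zero; suc; _<_; _∸_; _<?_)
open import Data.Fin using (Fin; toℕ; fromℕ<; opposite; #_)
open import Data.Fin.Properties using (any?)
open import Data.Fin using (_≟_)
open import Data.Vec using (Vec; []; _∷_; lookup; tabulate; reverse; map)
open import Data.List using (List; length) renaming ([] to []ₗ; _∷_ to _∷ₗ_; map to mapₗ)
open import Data.List.Membership.Propositional using (_∈_)
open import Data.List.Relation.Unary.Unique.Propositional using (Unique)
open import Data.Product using (Σ; Σ-syntax; ∃; ∃-syntax; _×_; _,_)
open import Relation.Nullary using (¬_; yes; no)
open import Relation.Binary.PropositionalEquality using (_≡_)
open import Function.Bundles using (_⇔_)

-- A bi-vincular pattern (σ, X, Y) of length k.
-- σ is a permutation of [k] in one-line notation, stored 0-based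
-- (the entry a : Fin k stands for the value toℕ a + 1); X, Y ⊆ {0,…,k}
-- are given as lists (only membership matters).
record BiVincular : Set where
  constructor bv
  field
    k : ℕ
    σ : Vec (Fin k) k
    X : List ℕ
    Y : List ℕ

open BiVincular public

invPerm : {k : ℕ} → Vec (Fin k) k → Vec (Fin k) k
invPerm {k} s = tabulate f
  where
  f : Fin k → Fin k
  f m with any? (λ a → lookup s a ≟ m)
  ... | yes (a , _) = a
  ... | no _ = m

pᵢ : BiVincular → BiVincular
pᵢ (bv k s X Y) = bv k (invPerm s) Y X

pᵣ : BiVincular → BiVincular
pᵣ (bv k s X Y) = bv k (reverse s) (mapₗ (λ x → k ∸ x) X) Y

pᶜ : BiVincular → BiVincular
pᶜ (bv k s X Y) = bv k (map opposite s) X (mapₗ (λ y → k ∸ y) Y)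

data Sym : Set where
  I R C : Sym

applySym : Sym → BiVincular → BiVincular
applySym I = pᵢ
applySym R = pᵣ
applySym C = pᶜ

-- finite composition of symmetry operations; the symmetry class of q is
-- { applySyms w q | w : List Sym }
applySyms : List Sym → BiVincular → BiVincular
applySyms []ₗ q = q
applySyms (s ∷ₗ w) q = applySym s (applySyms w q)

-- Extension of a (1-based) sequence f_1..f_k by f_0 = 0, f_{k+1} = n+1.
ext : (k n : ℕ) → (Fin k → ℕ) → ℕ → ℕ
ext k n f zero = 0
ext k n f (suc x) with x <? k
... | yes lt = f (fromℕ< lt)
... | no _ = suc n

-- A permutation of [n] in one-line notation, 0-based:
-- position toℕ i + 1 carries the value toℕ (lookup π i) + 1.
IsPerm : {n : ℕ} → Vec (Fin n) n → Set
IsPerm {n} π = ∀ a b → lookup π a ≡ lookup π b → a ≡ b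

Contains : (p : BiVincular) → {n : ℕ} → Vec (Fin n) n → Set
Contains (bv k s X Y) {n} π =
  Σ[ ι ∈ (Fin k → Fin n) ]
    ( (∀ a b → toℕ a < toℕ b → toℕ (ι a) < toℕ (ι b))
    × (∀ a b → (toℕ (lookup s a) < toℕ (lookup s b)) ⇔ (toℕ (lookup π (ι a)) < toℕ (lookup π (ι b))))
    × Σ[ j ∈ (Fin k → ℕ) ]
        ( (∀ a b → toℕ a < toℕ b → j a < j b)
        × (∀ m → ∃[ a ] (j m ≡ suc (toℕ (lookup π (ι a)))))
        × (∀ x → x ∈ X → ext k n (λ a → suc (toℕ (ι a))) (suc x) ≡ suc (ext k n (λ a → suc (toℕ (ι a))) x))
        × (∀ y → y ∈ Y → ext k n j (suc y) ≡ suc (ext k n j y))))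

Avoids : (p : BiVincular) → {n : ℕ} → Vec (Fin n) n → Set
Avoids p π = ¬ Contains p π

-- a_n(p) = m : there is a duplicate-free list consisting exactly of the
-- permutations of [n] avoiding p, and it has length m.
NumAvoiders : BiVincular → ℕ → ℕ → Set
NumAvoiders p n m =
  Σ[ L ∈ List (Vec (Fin n) n) ]
    ( Unique L
    × (∀ π → (π ∈ L) ⇔ (IsPerm π × Avoids p π))
    × length L ≡ m)

s123 s132 : Vec (Fin 3) 3
s123 = # 0 ∷ # 1 ∷ # 2 ∷ []
s132 = # 0 ∷ # 2 ∷ # 1 ∷ []


basePatterns : List BiVincular
basePatterns =
    bv 3 s123 (0 ∷ₗ []ₗ) (0 ∷ₗ 1 ∷ₗ 2 ∷ₗ []ₗ)
  ∷ₗ bv 3 s123 (0 ∷ₗ []ₗ) (0 ∷ₗ 1 ∷ₗ 3 ∷ₗ []ₗ)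
  ∷ₗ bv 3 s123 (0 ∷ₗ []ₗ) (0 ∷ₗ 2 ∷ₗ 3 ∷ₗ []ₗ)
  ∷ₗ bv 3 s123 (0 ∷ₗ []ₗ) (1 ∷ₗ 2 ∷ₗ 3 ∷ₗ []ₗ)
  ∷ₗ bv 3 s123 (1 ∷ₗ []ₗ) (0 ∷ₗ 1 ∷ₗ 2 ∷ₗ []ₗ)
  ∷ₗ bv 3 s123 (1 ∷ₗ []ₗ) (0 ∷ₗ 1 ∷ₗ 3 ∷ₗ []ₗ)
  ∷ₗ bv 3 s123 (1 ∷ₗ []ₗ) (0 ∷ₗ 2 ∷ₗ 3 ∷ₗ []ₗ)
  ∷ₗ bv 3 s123 (1 ∷ₗ []ₗ) (1 ∷ₗ 2 ∷ₗ 3 ∷ₗ []ₗ)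
  ∷ₗ bv 3 s132 (0 ∷ₗ []ₗ) (0 ∷ₗ 1 ∷ₗ 2 ∷ₗ []ₗ)
  ∷ₗ bv 3 s132 (0 ∷ₗ []ₗ) (0 ∷ₗ 1 ∷ₗ 3 ∷ₗ []ₗ)
  ∷ₗ bv 3 s132 (0 ∷ₗ []ₗ) (0 ∷ₗ 2 ∷ₗ 3 ∷ₗ []ₗ)
  ∷ₗ bv 3 s132 (0 ∷ₗ []ₗ) (1 ∷ₗ 2 ∷ₗ 3 ∷ₗ []ₗ)
  ∷ₗ bv 3 s132 (1 ∷ₗ []ₗ) (0 ∷ₗ 1 ∷ₗ 2 ∷ₗ []ₗ)
  ∷ₗ bv 3 s132 (1 ∷ₗ []ₗ) (0 ∷ₗ 1 ∷ₗ 3 ∷ₗ []ₗ)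
  ∷ₗ bv 3 s132 (1 ∷ₗ []ₗ) (0 ∷ₗ 2 ∷ₗ 3 ∷ₗ []ₗ)
  ∷ₗ bv 3 s132 (1 ∷ₗ []ₗ) (1 ∷ₗ 2 ∷ₗ 3 ∷ₗ []ₗ)
  ∷ₗ bv 3 s132 (2 ∷ₗ []ₗ) (0 ∷ₗ 1 ∷ₗ 2 ∷ₗ []ₗ)
  ∷ₗ bv 3 s132 (2 ∷ₗ []ₗ) (0 ∷ₗ 1 ∷ₗ 3 ∷ₗ []ₗ)
  ∷ₗ bv 3 s132 (2 ∷ₗ []ₗ) (0 ∷ₗ 2 ∷ₗ 3 ∷ₗ []ₗ)
  ∷ₗ bv 3 s132 (2 ∷ₗ []ₗ) (1 ∷ₗ 2 ∷ₗ 3 ∷ₗ []ₗ)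
  ∷ₗ bv 3 s132 (0 ∷ₗ 1 ∷ₗ 2 ∷ₗ []ₗ) (3 ∷ₗ []ₗ)
  ∷ₗ bv 3 s132 (3 ∷ₗ []ₗ) (0 ∷ₗ 1 ∷ₗ 3 ∷ₗ []ₗ)
  ∷ₗ bv 3 s132 (3 ∷ₗ []ₗ) (0 ∷ₗ 2 ∷ₗ 3 ∷ₗ []ₗ)
  ∷ₗ bv 3 s132 (3 ∷ₗ []ₗ) (1 ∷ₗ 2 ∷ₗ 3 ∷ₗ []ₗ)
  ∷ₗ []ₗ

module Submission where

-- Each base pattern is the image, under at most three of the symmetries
-- i, r, c, of a canonical pattern (τ, X, Y): X pins every occurrence to the
-- positions 1,2,3 (X = {0,1,2}) or 1,2,n (X = {0,1,3}), and Y = {0} (the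
-- smallest value of the occurrence is 1) or Y = {1} (its two smallest values
-- are consecutive).

open import Defs
open import Data.Nat using (ℕ; _≤_; _∸_; _!)
open import Data.Nat.DivMod using (_/_)
open import Data.List using (List)
open import Data.List.Membership.Propositional using (_∈_)

open import Data.Nat using (zero; suc; _+_; _*_; _<_; _≟_; _<?_; _≤?_; z≤n; s≤s)
import Data.Nat.Properties as NP
open import Data.Nat.DivMod using (m*n/n≡m)
open import Data.Fin as F using (Fin; toℕ; opposite; punchIn; punchOut; inject₁)
import Data.Fin.Properties as FP
open import Data.Fin.Permutation.Components using (transpose)
open import Data.Vec using (Vec; lookup; tabulate) renaming (_∷_ to _∷ᵥ_; [] to []ᵥ)
import Data.Vec as V
import Data.Vec.Properties as VP
open import Data.List using ([]; _∷_; length; map; filter; allFin; cartesianProductWith)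
import Data.List.Properties as LP
import Data.List.Membership.Propositional.Properties as MP
open import Data.List.Membership.Propositional.Properties.WithK using (unique∧set⇒bag)
open import Data.List.Relation.Binary.BagAndSetEquality using (∼bag⇒↭)
open import Data.List.Relation.Binary.Permutation.Propositional.Properties using (↭-length)
open import Data.List.Relation.Unary.Any using (here; there)
open import Data.List.Relation.Unary.All as All using (All; []; _∷_)
open import Data.List.Relation.Unary.AllPairs using ([]; _∷_)
open import Data.List.Relation.Unary.Unique.Propositional using (Unique)
import Data.List.Relation.Unary.Unique.Propositional.Properties as UP
open import Data.Product using (∃-syntax; _×_; _,_; proj₁; proj₂)
open import Data.Sum using (_⊎_; inj₁; inj₂)
open import Data.Empty using (⊥-elim)
open import Relation.Nullary using (¬_; yes; no; ¬?)
open import Relation.Nullary.Decidable using (_×-dec_; True; toWitness)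
open import Relation.Unary using (Decidable)
open import Relation.Binary.PropositionalEquality
open import Relation.Binary.Definitions using (tri<; tri≈; tri>)
open import Function.Bundles using (_⇔_; mk⇔; Equivalence)
open import Function using (_∘_)
open import Function.Construct.Composition using (_⇔-∘_)
open import Function.Construct.Identity using (⇔-id)

pattern 0F = F.zero
pattern 1F = F.suc F.zero
pattern 2F = F.suc (F.suc F.zero)

fwd : ∀ {A B : Set} → A ⇔ B → A → B
fwd = Equivalence.to

bwd : ∀ {A B : Set} → A ⇔ B → B → A
bwd = Equivalence.from

≡⇒⇔ : ∀ {A : Set} (F : A → Set) {x y : A} → x ≡ y → F x ⇔ F y
≡⇒⇔ F refl = ⇔-id _

≡₂⇒⇔ : ∀ {A : Set} (F : A → A → Set) {x₁ x₂ y₁ y₂ : A} → x₁ ≡ y₁ → x₂ ≡ y₂ → F x₁ x₂ ⇔ F y₁ y₂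
≡₂⇒⇔ F refl refl = ⇔-id _

Fin3-elim : (P : Fin 3 → Set) → P 0F → P 1F → P 2F → ∀ a → P a
Fin3-elim P p0 p1 p2 0F = p0
Fin3-elim P p0 p1 p2 1F = p1
Fin3-elim P p0 p1 p2 2F = p2

-- A sequence indexed by Fin k is strictly increasing.  Positions of an
-- occurrence and the sorted list of its values are such sequences.
Increasing : ∀ {k} → (Fin k → ℕ) → Set
Increasing f = ∀ a b → toℕ a < toℕ b → f a < f b

increasing-reflects : ∀ {k} (f : Fin k → ℕ) → Increasing f → ∀ a b → f a < f b → toℕ a < toℕ b
increasing-reflects f inc a b lt with NP.<-cmp (toℕ a) (toℕ b)
... | tri< a<b _ _ = a<b
... | tri≈ _ a≡b _ rewrite FP.toℕ-injective a≡b = ⊥-elim (NP.<-irrefl refl lt)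
... | tri> _ _ b<a = ⊥-elim (NP.<-asym lt (inc b a b<a))

increasing-iff : ∀ {k} (f : Fin k → ℕ) → Increasing f → ∀ a b → (toℕ a < toℕ b) ⇔ (f a < f b)
increasing-iff f inc a b = mk⇔ (inc a b) (increasing-reflects f inc a b)

increasing-injective : ∀ {k n} (ι : Fin k → Fin n) → Increasing (toℕ ∘ ι) → ∀ {a b} → ι a ≡ ι b → a ≡ b
increasing-injective ι inc {a} {b} e with NP.<-cmp (toℕ a) (toℕ b)
... | tri< a<b _ _ = ⊥-elim (NP.<-irrefl (cong toℕ e) (inc a b a<b))
... | tri≈ _ a≡b _ = FP.toℕ-injective a≡b
... | tri> _ _ b<a = ⊥-elim (NP.<-irrefl (cong toℕ (sym e)) (inc b a b<a))

increasing₃ : (g : Fin 3 → ℕ) → g 0F < g 1F → g 1F < g 2F → Increasing g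
increasing₃ g l01 l12 0F 1F _ = l01
increasing₃ g l01 l12 0F 2F _ = NP.<-trans l01 l12
increasing₃ g l01 l12 1F 2F _ = l12
increasing₃ g l01 l12 0F 0F ()
increasing₃ g l01 l12 1F 0F ()
increasing₃ g l01 l12 1F 1F (s≤s ())
increasing₃ g l01 l12 2F 0F ()
increasing₃ g l01 l12 2F 1F (s≤s ())
increasing₃ g l01 l12 2F 2F (s≤s (s≤s ()))

-- The only increasing self-map of Fin 3 is the identity.  This makes the
-- sorted list of values of an occurrence determined by its positions.
increasing-self-map₃ : (g : Fin 3 → Fin 3) → Increasing (toℕ ∘ g) → ∀ a → g a ≡ a
increasing-self-map₃ g inc = Fin3-elim _ (FP.toℕ-injective g0) (FP.toℕ-injective g1) (FP.toℕ-injective g2)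
  where
  l01 : toℕ (g 0F) < toℕ (g 1F)
  l01 = inc 0F 1F (s≤s z≤n)
  l12 : toℕ (g 1F) < toℕ (g 2F)
  l12 = inc 1F 2F (s≤s (s≤s z≤n))
  g2 : toℕ (g 2F) ≡ 2
  g2 = NP.≤-antisym (NP.≤-pred (FP.toℕ<n (g 2F))) (NP.≤-trans (s≤s (s≤s z≤n)) (NP.≤-trans (s≤s l01) l12))
  g1 : toℕ (g 1F) ≡ 1
  g1 = NP.≤-antisym (NP.≤-pred (subst (toℕ (g 1F) <_) g2 l12)) (NP.≤-trans (s≤s z≤n) l01)
  g0 : toℕ (g 0F) ≡ 0
  g0 = NP.n≤0⇒n≡0 (NP.≤-pred (subst (toℕ (g 0F) <_) g1 l01))

opposite-+ : ∀ {n} (v : Fin n) → toℕ (opposite v) + suc (toℕ v) ≡ n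
opposite-+ v rewrite FP.opposite-prop v = NP.m∸n+n≡m (FP.toℕ<n v)

opposite-reverses : ∀ {n} (a b : Fin n) → toℕ a < toℕ b → toℕ (opposite b) < toℕ (opposite a)
opposite-reverses a b lt rewrite FP.opposite-prop a | FP.opposite-prop b =
  NP.∸-monoʳ-< (s≤s lt) (FP.toℕ<n b)

opposite-iff : ∀ {n} (a b : Fin n) → (toℕ a < toℕ b) ⇔ (toℕ (opposite b) < toℕ (opposite a))
opposite-iff a b = mk⇔ (opposite-reverses a b) λ lt →
  subst₂ (λ x y → toℕ x < toℕ y) (FP.opposite-involutive a) (FP.opposite-involutive b)
    (opposite-reverses (opposite b) (opposite a) lt)

complement-adjacent : ∀ {x a y b s} → x + a ≡ s → y + b ≡ s → (b ≡ suc a) ⇔ (x ≡ suc y)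
complement-adjacent {x} {a} {y} {b} xa ya = mk⇔
  (λ b≡1+a → NP.+-cancelʳ-≡ a x (suc y)
     (trans xa (trans (sym ya) (trans (cong (y +_) b≡1+a) (NP.+-suc y a)))))
  (λ x≡1+y → NP.+-cancelˡ-≡ y b (suc a)
     (trans ya (trans (sym xa) (trans (cong (_+ a) x≡1+y) (sym (NP.+-suc y a))))))

opposite-consecutive : ∀ {n} (u v : Fin n) → (toℕ v ≡ suc (toℕ u)) ⇔ (toℕ (opposite u) ≡ suc (toℕ (opposite v)))
opposite-consecutive u v = mk⇔ (fwd sums ∘ cong suc) (NP.suc-injective ∘ bwd sums)
  where
  sums : (suc (toℕ v) ≡ suc (suc (toℕ u))) ⇔ (toℕ (opposite u) ≡ suc (toℕ (opposite v)))
  sums = complement-adjacent (opposite-+ u) (opposite-+ v)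

below-consecutive : ∀ {u v w} → v ≡ suc u → w ≢ u → (w < v) ⇔ (w < u)
below-consecutive {w = w} v≡1+u w≢u = mk⇔
  (λ w<v → NP.≤∧≢⇒< (NP.≤-pred (subst (w <_) v≡1+u w<v)) w≢u)
  (λ w<u → subst (w <_) (sym v≡1+u) (NP.m<n⇒m<1+n w<u))

not-below : ∀ {x y} → x ≢ y → (¬ x < y) ⇔ (y < x)
not-below x≢y = mk⇔ (λ x≮y → NP.≤∧≢⇒< (NP.≮⇒≥ x≮y) (x≢y ∘ sym)) (λ y<x x<y → NP.<-asym x<y y<x)

ext-cong : ∀ {k n} (f g : Fin k → ℕ) → (∀ a → f a ≡ g a) → ∀ x → ext k n f x ≡ ext k n g x
ext-cong f g f≗g zero = refl
ext-cong {k} f g f≗g (suc x) with x <? k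
... | yes lt = f≗g (F.fromℕ< lt)
... | no _ = refl

ext-mirror : ∀ {n} (f f' : Fin 3 → ℕ) → (∀ a → f' a + f (opposite a) ≡ suc n) →
  ∀ y → y ≤ 4 → ext 3 n f' y + ext 3 n f (4 ∸ y) ≡ suc n
ext-mirror f f' mirror 0 _ = refl
ext-mirror f f' mirror 1 _ = mirror 0F
ext-mirror f f' mirror 2 _ = mirror 1F
ext-mirror f f' mirror 3 _ = mirror 2F
ext-mirror {n} f f' mirror 4 _ = NP.+-identityʳ (suc n)
ext-mirror f f' mirror (suc (suc (suc (suc (suc y))))) (s≤s (s≤s (s≤s (s≤s ()))))

-- Hence an adjacency of f in the gap x is one of f' in the gap 3 - x.  This
-- is how the adjacency sets X resp. Y transform under reverse resp. complement.
adjacent-mirror : ∀ {n} (f f' : Fin 3 → ℕ) → (∀ a → f' a + f (opposite a) ≡ suc n) →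
  ∀ x → x ≤ 3 → ext 3 n f (suc x) ≡ suc (ext 3 n f x) →
  ext 3 n f' (suc (3 ∸ x)) ≡ suc (ext 3 n f' (3 ∸ x))
adjacent-mirror {n} f f' mirror x x≤3 = fwd (complement-adjacent outer inner)
  where
  3-x≤3 : 3 ∸ x ≤ 3
  3-x≤3 = NP.m∸n≤m 3 x
  outer : ext 3 n f' (suc (3 ∸ x)) + ext 3 n f x ≡ suc n
  outer = subst (λ z → ext 3 n f' (suc (3 ∸ x)) + ext 3 n f z ≡ suc n) (NP.m∸[m∸n]≡n x≤3)
    (ext-mirror f f' mirror (suc (3 ∸ x)) (s≤s 3-x≤3))
  4-[3-x] : 4 ∸ (3 ∸ x) ≡ suc x
  4-[3-x] = trans (NP.+-∸-assoc 1 3-x≤3) (cong suc (NP.m∸[m∸n]≡n x≤3))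
  inner : ext 3 n f' (3 ∸ x) + ext 3 n f (suc x) ≡ suc n
  inner = subst (λ z → ext 3 n f' (3 ∸ x) + ext 3 n f z ≡ suc n) 4-[3-x]
    (ext-mirror f f' mirror (3 ∸ x) (NP.≤-trans 3-x≤3 (NP.n≤1+n 3)))

MirrorOf : List ℕ → List ℕ → Set
MirrorOf X' X = ∀ x' → x' ∈ X' → ∃[ x ] (x ∈ X × x ≤ 3 × x' ≡ 3 ∸ x)

-- Occurrences of patterns of length 3

Perm : ℕ → Set
Perm n = Vec (Fin n) n

OrderIso : ∀ {n} → Vec (Fin 3) 3 → Perm n → (Fin 3 → Fin n) → Set
OrderIso s π ι = ∀ a b → (toℕ (lookup s a) < toℕ (lookup s b)) ⇔ (toℕ (lookup π (ι a)) < toℕ (lookup π (ι b)))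

ValuesOf : ∀ {n} → Perm n → (Fin 3 → Fin n) → (Fin 3 → ℕ) → Set
ValuesOf π ι j = ∀ m → ∃[ a ] (j m ≡ suc (toℕ (lookup π (ι a))))

sorted-values : ∀ {n} (s t : Vec (Fin 3) 3) (π : Perm n) (ι : Fin 3 → Fin n) (j : Fin 3 → ℕ) →
  OrderIso s π ι → Increasing j → ValuesOf π ι j → (∀ a → lookup t (lookup s a) ≡ a) →
  ∀ m → j m ≡ suc (toℕ (lookup π (ι (lookup t m))))
sorted-values s t π ι j iso j-inc values t∘s m =
  trans (proj₂ (values m)) (cong (λ z → suc (toℕ (lookup π (ι z)))) (which≡t m))
  where
  which : Fin 3 → Fin 3
  which m = proj₁ (values m)
  s∘which-increasing : Increasing (toℕ ∘ lookup s ∘ which)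
  s∘which-increasing a b lt = bwd (iso (which a) (which b))
    (NP.≤-pred (subst₂ _<_ (proj₂ (values a)) (proj₂ (values b)) (j-inc a b lt)))
  which≡t : ∀ m → which m ≡ lookup t m
  which≡t m = trans (sym (t∘s (which m)))
    (cong (lookup t) (increasing-self-map₃ (lookup s ∘ which) s∘which-increasing m))

-- An occurrence of (s, X, Y) in π yields one of the inverse pattern (t, Y, X)
-- in the inverse permutation ρ: positions and values trade places.
contains-inverse : ∀ {n} (s t : Vec (Fin 3) 3) X Y (π ρ : Perm n) →
  (∀ a → lookup t (lookup s a) ≡ a) → (∀ i → lookup ρ (lookup π i) ≡ i) →
  Contains (bv 3 s X Y) π → Contains (bv 3 t Y X) ρ
contains-inverse {n} s t X Y π ρ t∘s ρ∘π (ι , ι-inc , iso , j , j-inc , values , X-adj , Y-adj) =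
  ι' , ι'-inc , iso' , j' , (λ a b lt → s≤s (ι-inc a b lt)) , values' , Y-adj' , X-adj
  where
  j≡ : ∀ m → j m ≡ suc (toℕ (lookup π (ι (lookup t m))))
  j≡ = sorted-values s t π ι j iso j-inc values t∘s
  ι' : Fin 3 → Fin n
  ι' a = lookup π (ι (lookup t a))
  ι'-inc : Increasing (toℕ ∘ ι')
  ι'-inc a b lt = NP.≤-pred (subst₂ _<_ (j≡ a) (j≡ b) (j-inc a b lt))
  iso' : OrderIso t ρ ι'
  iso' a b rewrite ρ∘π (ι (lookup t a)) | ρ∘π (ι (lookup t b)) =
    increasing-iff (toℕ ∘ ι) ι-inc (lookup t a) (lookup t b)
  j' : Fin 3 → ℕ
  j' a = suc (toℕ (ι a))
  values' : ValuesOf ρ ι' j'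
  values' m = lookup s m , cong (suc ∘ toℕ) (sym (trans (ρ∘π _) (cong ι (t∘s m))))
  Y-adj' : ∀ y → y ∈ Y → ext 3 n (λ a → suc (toℕ (ι' a))) (suc y) ≡ suc (ext 3 n (λ a → suc (toℕ (ι' a))) y)
  Y-adj' y y∈ = trans (ext-cong _ _ (λ a → sym (j≡ a)) (suc y)) (trans (Y-adj y y∈) (cong suc (ext-cong _ _ j≡ y)))

contains-reverse : ∀ {n} (s s' : Vec (Fin 3) 3) X X' Y (π π' : Perm n) →
  (∀ a → lookup s' a ≡ lookup s (opposite a)) → (∀ i → lookup π' i ≡ lookup π (opposite i)) →
  MirrorOf X' X → Contains (bv 3 s X Y) π → Contains (bv 3 s' X' Y) π'
contains-reverse {n} s s' X X' Y π π' s'≡ π'≡ X'-mirror (ι , ι-inc , iso , j , j-inc , values , X-adj , Y-adj) =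
  ι' , ι'-inc , iso' , j , j-inc , values' , X'-adj , Y-adj
  where
  ι' : Fin 3 → Fin n
  ι' a = opposite (ι (opposite a))
  ι'-inc : Increasing (toℕ ∘ ι')
  ι'-inc a b lt = opposite-reverses _ _ (ι-inc (opposite b) (opposite a) (opposite-reverses a b lt))
  π'ι' : ∀ a → lookup π' (ι' a) ≡ lookup π (ι (opposite a))
  π'ι' a = trans (π'≡ (ι' a)) (cong (lookup π) (FP.opposite-involutive _))
  iso' : OrderIso s' π' ι'
  iso' a b rewrite s'≡ a | s'≡ b | π'ι' a | π'ι' b = iso (opposite a) (opposite b)
  values' : ValuesOf π' ι' j
  values' m with values m
  ... | a , e = opposite a , trans e (cong (suc ∘ toℕ)
    (sym (trans (π'ι' (opposite a)) (cong (λ z → lookup π (ι z)) (FP.opposite-involutive a)))))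
  mirror : ∀ a → suc (toℕ (ι' a)) + suc (toℕ (ι (opposite a))) ≡ suc n
  mirror a = cong suc (opposite-+ (ι (opposite a)))
  X'-adj : ∀ x' → x' ∈ X' → ext 3 n (λ a → suc (toℕ (ι' a))) (suc x') ≡ suc (ext 3 n (λ a → suc (toℕ (ι' a))) x')
  X'-adj x' x'∈ with X'-mirror x' x'∈
  ... | x , x∈ , x≤3 , refl = adjacent-mirror _ _ mirror x x≤3 (X-adj x x∈)

contains-complement : ∀ {n} (s s' : Vec (Fin 3) 3) X Y Y' (π π' : Perm n) →
  (∀ a → lookup s' a ≡ opposite (lookup s a)) → (∀ i → lookup π' i ≡ opposite (lookup π i)) →
  MirrorOf Y' Y → Contains (bv 3 s X Y) π → Contains (bv 3 s' X Y') π'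
contains-complement {n} s s' X Y Y' π π' s'≡ π'≡ Y'-mirror (ι , ι-inc , iso , j , j-inc , values , X-adj , Y-adj) =
  ι , ι-inc , iso' , j' , j'-inc , values' , X-adj , Y'-adj
  where
  iso' : OrderIso s' π' ι
  iso' a b rewrite s'≡ a | s'≡ b | π'≡ (ι a) | π'≡ (ι b) =
    mk⇔ (λ lt → fwd (opposite-iff _ _) (fwd (iso b a) (bwd (opposite-iff _ _) lt)))
        (λ lt → fwd (opposite-iff _ _) (bwd (iso b a) (bwd (opposite-iff _ _) lt)))
  -- the (m+1)-th largest value of the occurrence in π
  v : Fin 3 → Fin n
  v m = lookup π (ι (proj₁ (values (opposite m))))
  j' : Fin 3 → ℕ
  j' m = suc (toℕ (opposite (v m)))
  j'-inc : Increasing j'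
  j'-inc a b lt = s≤s (opposite-reverses (v b) (v a)
    (NP.≤-pred (subst₂ _<_ (proj₂ (values (opposite b))) (proj₂ (values (opposite a)))
       (j-inc (opposite b) (opposite a) (opposite-reverses a b lt)))))
  values' : ValuesOf π' ι j'
  values' m = proj₁ (values (opposite m)) , cong (suc ∘ toℕ) (sym (π'≡ _))
  mirror : ∀ m → j' m + j (opposite m) ≡ suc n
  mirror m = trans (cong (j' m +_) (proj₂ (values (opposite m)))) (cong suc (opposite-+ (v m)))
  Y'-adj : ∀ y' → y' ∈ Y' → ext 3 n j' (suc y') ≡ suc (ext 3 n j' y')
  Y'-adj y' y'∈ with Y'-mirror y' y'∈
  ... | y , y∈ , y≤3 , refl = adjacent-mirror j j' mirror y y≤3 (Y-adj y y∈)

lookup-extensionality : ∀ {A : Set} {n} (xs ys : Vec A n) → (∀ i → lookup xs i ≡ lookup ys i) → xs ≡ ys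
lookup-extensionality xs ys eq =
  trans (sym (VP.tabulate∘lookup xs)) (trans (VP.tabulate-cong eq) (VP.tabulate∘lookup ys))

-- Pigeonhole: an injective self-map of Fin n is surjective.
perm-surjective : ∀ {n} (π : Perm n) → IsPerm π → ∀ v → ∃[ i ] lookup π i ≡ v
perm-surjective {suc n} π inj v with FP.any? (λ i → lookup π i F.≟ v)
... | yes hit = hit
... | no miss with FP.pigeonhole (NP.n<1+n n) (λ i → punchOut {i = v} {j = lookup π i} (miss ∘ (i ,_) ∘ sym))
...   | i , j , i<j , eq = ⊥-elim (FP.<-irrefl (inj i j
        (FP.punchOut-injective {i = v} (miss ∘ (i ,_) ∘ sym) (miss ∘ (j ,_) ∘ sym) eq)) i<j)

-- The inverse permutation, by searching for preimages.  (Same construction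
-- as invPerm, but with a named defining function we can reason about.)
preimage : ∀ {n} → Perm n → Fin n → Fin n
preimage π v with FP.any? (λ i → lookup π i F.≟ v)
... | yes (i , _) = i
... | no _ = v

preimage-spec : ∀ {n} (π : Perm n) v → (∃[ i ] lookup π i ≡ v) → lookup π (preimage π v) ≡ v
preimage-spec π v hit with FP.any? (λ i → lookup π i F.≟ v)
... | yes (i , eq) = eq
... | no miss = ⊥-elim (miss hit)

inverse : ∀ {n} → Perm n → Perm n
inverse π = tabulate (preimage π)

inverse-right : ∀ {n} (π : Perm n) → IsPerm π → ∀ v → lookup π (lookup (inverse π) v) ≡ v
inverse-right π π-perm v rewrite VP.lookup∘tabulate (preimage π) v =
  preimage-spec π v (perm-surjective π π-perm v)

inverse-left : ∀ {n} (π : Perm n) → IsPerm π → ∀ i → lookup (inverse π) (lookup π i) ≡ i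
inverse-left π π-perm i = π-perm _ _ (inverse-right π π-perm (lookup π i))

reverse : ∀ {n} → Perm n → Perm n
reverse π = tabulate (λ i → lookup π (opposite i))

reverse-lookup : ∀ {n} (π : Perm n) i → lookup (reverse π) i ≡ lookup π (opposite i)
reverse-lookup π = VP.lookup∘tabulate _

complement : ∀ {n} → Perm n → Perm n
complement π = tabulate (λ i → opposite (lookup π i))

complement-lookup : ∀ {n} (π : Perm n) i → lookup (complement π) i ≡ opposite (lookup π i)
complement-lookup π = VP.lookup∘tabulate _

opposite-injective : ∀ {n} {a b : Fin n} → opposite a ≡ opposite b → a ≡ b
opposite-injective {a = a} {b} eq =
  trans (sym (FP.opposite-involutive a)) (trans (cong opposite eq) (FP.opposite-involutive b))

record Involution (n : ℕ) : Set where
  field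
    apply : Perm n → Perm n
    preserves : ∀ π → IsPerm π → IsPerm (apply π)
    involutive : ∀ π → IsPerm π → apply (apply π) ≡ π

open Involution

inverse-involution : ∀ {n} → Involution n
inverse-involution = record { apply = inverse ; preserves = inverse-perm ; involutive = inverse-inverse }
  where
  inverse-perm : ∀ π → IsPerm π → IsPerm (inverse π)
  inverse-perm π π-perm a b eq =
    trans (sym (inverse-right π π-perm a)) (trans (cong (lookup π) eq) (inverse-right π π-perm b))
  inverse-inverse : ∀ π → IsPerm π → inverse (inverse π) ≡ π
  inverse-inverse π π-perm = lookup-extensionality _ _ λ i → inverse-perm π π-perm _ _
    (trans (inverse-right (inverse π) (inverse-perm π π-perm) i) (sym (inverse-left π π-perm i)))

reverse-involution : ∀ {n} → Involution n
reverse-involution = record { apply = reverse ; preserves = reverse-perm ; involutive = λ π _ → reverse-reverse π }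
  where
  reverse-perm : ∀ π → IsPerm π → IsPerm (reverse π)
  reverse-perm π π-perm a b eq = opposite-injective (π-perm _ _
    (trans (sym (reverse-lookup π a)) (trans eq (reverse-lookup π b))))
  reverse-reverse : ∀ π → reverse (reverse π) ≡ π
  reverse-reverse π = lookup-extensionality _ _ λ i → trans (reverse-lookup (reverse π) i)
    (trans (reverse-lookup π (opposite i)) (cong (lookup π) (FP.opposite-involutive i)))

complement-involution : ∀ {n} → Involution n
complement-involution = record { apply = complement ; preserves = complement-perm ; involutive = λ π _ → complement-complement π }
  where
  complement-perm : ∀ π → IsPerm π → IsPerm (complement π)
  complement-perm π π-perm a b eq = π-perm a b (opposite-injective
    (trans (sym (complement-lookup π a)) (trans eq (complement-lookup π b))))
  complement-complement : ∀ π → complement (complement π) ≡ π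
  complement-complement π = lookup-extensionality _ _ λ i → trans (complement-lookup (complement π) i)
    (trans (cong opposite (complement-lookup π i)) (FP.opposite-involutive _))

map-unique : ∀ {A B : Set} (f : A → B) {xs : List A} → Unique xs →
  (∀ {x y} → x ∈ xs → y ∈ xs → f x ≡ f y → x ≡ y) → Unique (map f xs)
map-unique f {[]} [] inj = []
map-unique f {x ∷ xs} (x∉xs ∷ u) inj =
  All.tabulate (λ {y} y∈ fx≡y → let (x' , x'∈ , y≡) = MP.∈-map⁻ f y∈ in
     All.lookup x∉xs x'∈ (inj (here refl) (there x'∈) (trans fx≡y y≡)))
  ∷ map-unique f u (λ x∈ y∈ → inj (there x∈) (there y∈))

-- If an involution φ of S_n carries the occurrences of q onto those of p,
-- then p and q have equally many avoiders (the image of the list of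
-- p-avoiders under φ lists the q-avoiders).
avoiders-transfer : ∀ {n m} (p q : BiVincular) (φ : Involution n) →
  (∀ π → IsPerm π → Contains q π → Contains p (apply φ π)) →
  (∀ π → IsPerm π → Contains p (apply φ π) → Contains q π) →
  NumAvoiders p n m → NumAvoiders q n m
avoiders-transfer p q φ q⇒p p⇒q (L , L-unique , L-members , L-length) =
  map (apply φ) L , map-unique (apply φ) L-unique injective , (λ π → mk⇔ (member⇒ π) (⇒member π)) ,
  trans (LP.length-map (apply φ) L) L-length
  where
  injective : ∀ {x y} → x ∈ L → y ∈ L → apply φ x ≡ apply φ y → x ≡ y
  injective {x} {y} x∈ y∈ eq = trans (sym (involutive φ x (proj₁ (fwd (L-members x) x∈))))
    (trans (cong (apply φ) eq) (involutive φ y (proj₁ (fwd (L-members y) y∈))))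
  member⇒ : ∀ π → π ∈ map (apply φ) L → IsPerm π × Avoids q π
  member⇒ π π∈ with MP.∈-map⁻ (apply φ) π∈
  ... | σ , σ∈ , refl with fwd (L-members σ) σ∈
  ...   | σ-perm , σ-avoids = preserves φ σ σ-perm ,
          λ c → σ-avoids (subst (Contains p) (involutive φ σ σ-perm) (q⇒p _ (preserves φ σ σ-perm) c))
  ⇒member : ∀ π → IsPerm π × Avoids q π → π ∈ map (apply φ) L
  ⇒member π (π-perm , π-avoids) = subst (_∈ map (apply φ) L) (involutive φ π π-perm)
    (MP.∈-map⁺ (apply φ) (bwd (L-members (apply φ π)) (preserves φ π π-perm , λ c → π-avoids (p⇒q π π-perm c))))

-- Symmetries of patterns of length 3

v3 : Fin 3 → Fin 3 → Fin 3 → Vec (Fin 3) 3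
v3 a b c = a ∷ᵥ b ∷ᵥ c ∷ᵥ []ᵥ

data IsPerm3 : Vec (Fin 3) 3 → Set where
  ⟨123⟩ : IsPerm3 (v3 0F 1F 2F)
  ⟨132⟩ : IsPerm3 (v3 0F 2F 1F)
  ⟨213⟩ : IsPerm3 (v3 1F 0F 2F)
  ⟨231⟩ : IsPerm3 (v3 1F 2F 0F)
  ⟨312⟩ : IsPerm3 (v3 2F 0F 1F)
  ⟨321⟩ : IsPerm3 (v3 2F 1F 0F)

invPerm-left : ∀ {σ} → IsPerm3 σ → ∀ a → lookup (invPerm σ) (lookup σ a) ≡ a
invPerm-left ⟨123⟩ = Fin3-elim _ refl refl refl
invPerm-left ⟨132⟩ = Fin3-elim _ refl refl refl
invPerm-left ⟨213⟩ = Fin3-elim _ refl refl refl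
invPerm-left ⟨231⟩ = Fin3-elim _ refl refl refl
invPerm-left ⟨312⟩ = Fin3-elim _ refl refl refl
invPerm-left ⟨321⟩ = Fin3-elim _ refl refl refl

invPerm-right : ∀ {σ} → IsPerm3 σ → ∀ a → lookup σ (lookup (invPerm σ) a) ≡ a
invPerm-right ⟨123⟩ = Fin3-elim _ refl refl refl
invPerm-right ⟨132⟩ = Fin3-elim _ refl refl refl
invPerm-right ⟨213⟩ = Fin3-elim _ refl refl refl
invPerm-right ⟨231⟩ = Fin3-elim _ refl refl refl
invPerm-right ⟨312⟩ = Fin3-elim _ refl refl refl
invPerm-right ⟨321⟩ = Fin3-elim _ refl refl refl

invPerm-perm3 : ∀ {σ} → IsPerm3 σ → IsPerm3 (invPerm σ)
invPerm-perm3 ⟨123⟩ = ⟨123⟩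
invPerm-perm3 ⟨132⟩ = ⟨132⟩
invPerm-perm3 ⟨213⟩ = ⟨213⟩
invPerm-perm3 ⟨231⟩ = ⟨312⟩
invPerm-perm3 ⟨312⟩ = ⟨231⟩
invPerm-perm3 ⟨321⟩ = ⟨321⟩

reverse-lookup₃ : ∀ {σ} → IsPerm3 σ → ∀ a → lookup (V.reverse σ) a ≡ lookup σ (opposite a)
reverse-lookup₃ ⟨123⟩ = Fin3-elim _ refl refl refl
reverse-lookup₃ ⟨132⟩ = Fin3-elim _ refl refl refl
reverse-lookup₃ ⟨213⟩ = Fin3-elim _ refl refl refl
reverse-lookup₃ ⟨231⟩ = Fin3-elim _ refl refl refl
reverse-lookup₃ ⟨312⟩ = Fin3-elim _ refl refl refl
reverse-lookup₃ ⟨321⟩ = Fin3-elim _ refl refl refl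

reverse-perm3 : ∀ {σ} → IsPerm3 σ → IsPerm3 (V.reverse σ)
reverse-perm3 ⟨123⟩ = ⟨321⟩
reverse-perm3 ⟨132⟩ = ⟨231⟩
reverse-perm3 ⟨213⟩ = ⟨312⟩
reverse-perm3 ⟨231⟩ = ⟨132⟩
reverse-perm3 ⟨312⟩ = ⟨213⟩
reverse-perm3 ⟨321⟩ = ⟨123⟩

complement-perm3 : ∀ {σ} → IsPerm3 σ → IsPerm3 (V.map opposite σ)
complement-perm3 ⟨123⟩ = ⟨321⟩
complement-perm3 ⟨132⟩ = ⟨312⟩
complement-perm3 ⟨213⟩ = ⟨231⟩
complement-perm3 ⟨231⟩ = ⟨213⟩
complement-perm3 ⟨312⟩ = ⟨132⟩
complement-perm3 ⟨321⟩ = ⟨123⟩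

-- Patterns of length 3 with a genuine permutation and X, Y ⊆ {0,…,3}; the
-- class closed under the symmetries on which the transfer lemmas apply.
data Length3 : BiVincular → Set where
  length3 : ∀ {σ X Y} → IsPerm3 σ → All (_≤ 3) X → All (_≤ 3) Y → Length3 (bv 3 σ X Y)

mirror-bounded : (X : List ℕ) → All (_≤ 3) (map (3 ∸_) X)
mirror-bounded X = All.tabulate λ x∈ → let (x , _ , eq) = MP.∈-map⁻ (3 ∸_) x∈ in subst (_≤ 3) (sym eq) (NP.m∸n≤m 3 x)

mirror-of-mapped : (X : List ℕ) → All (_≤ 3) X → MirrorOf X (map (3 ∸_) X)
mirror-of-mapped X X≤3 x x∈ = 3 ∸ x , MP.∈-map⁺ (3 ∸_) x∈ , NP.m∸n≤m 3 x , sym (NP.m∸[m∸n]≡n (All.lookup X≤3 x∈))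

mapped-mirror-of : (X : List ℕ) → All (_≤ 3) X → MirrorOf (map (3 ∸_) X) X
mapped-mirror-of X X≤3 x' x'∈ with MP.∈-map⁻ (3 ∸_) x'∈
... | x , x∈ , eq = x , x∈ , All.lookup X≤3 x∈ , eq

symmetry-length3 : ∀ s p → Length3 p → Length3 (applySym s p)
symmetry-length3 I _ (length3 σ₃ X≤3 Y≤3) = length3 (invPerm-perm3 σ₃) Y≤3 X≤3
symmetry-length3 R _ (length3 {X = X} σ₃ X≤3 Y≤3) = length3 (reverse-perm3 σ₃) (mirror-bounded X) Y≤3
symmetry-length3 C _ (length3 {Y = Y} σ₃ X≤3 Y≤3) = length3 (complement-perm3 σ₃) X≤3 (mirror-bounded Y)

symmetry-count : ∀ {n m} s p → Length3 p → NumAvoiders p n m → NumAvoiders (applySym s p) n m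
symmetry-count I (bv _ σ X Y) (length3 σ₃ _ _) = avoiders-transfer (bv 3 σ X Y) (bv 3 (invPerm σ) Y X) inverse-involution
  (λ π π-perm → contains-inverse (invPerm σ) σ Y X π (inverse π) (invPerm-right σ₃) (inverse-left π π-perm))
  (λ π π-perm → contains-inverse σ (invPerm σ) X Y (inverse π) π (invPerm-left σ₃) (inverse-right π π-perm))
symmetry-count R (bv _ σ X Y) (length3 σ₃ X≤3 _) = avoiders-transfer (bv 3 σ X Y) (bv 3 (V.reverse σ) (map (3 ∸_) X) Y) reverse-involution
  (λ π _ → contains-reverse (V.reverse σ) σ (map (3 ∸_) X) X Y π (reverse π)
     (λ a → sym (trans (reverse-lookup₃ σ₃ (opposite a)) (cong (lookup σ) (FP.opposite-involutive a))))
     (reverse-lookup π) (mirror-of-mapped X X≤3))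
  (λ π _ → contains-reverse σ (V.reverse σ) X (map (3 ∸_) X) Y (reverse π) π (reverse-lookup₃ σ₃)
     (λ i → sym (trans (reverse-lookup π (opposite i)) (cong (lookup π) (FP.opposite-involutive i))))
     (mapped-mirror-of X X≤3))
symmetry-count C (bv _ σ X Y) (length3 σ₃ _ Y≤3) = avoiders-transfer (bv 3 σ X Y) (bv 3 (V.map opposite σ) X (map (3 ∸_) Y)) complement-involution
  (λ π _ → contains-complement (V.map opposite σ) σ X (map (3 ∸_) Y) Y π (complement π)
     (λ a → sym (trans (cong opposite (VP.lookup-map a opposite σ)) (FP.opposite-involutive _)))
     (complement-lookup π) (mirror-of-mapped Y Y≤3))
  (λ π _ → contains-complement σ (V.map opposite σ) X Y (map (3 ∸_) Y) (complement π) π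
     (λ a → VP.lookup-map a opposite σ)
     (λ i → sym (trans (cong opposite (complement-lookup π i)) (FP.opposite-involutive _)))
     (mapped-mirror-of Y Y≤3))

symmetries-length3 : ∀ w p → Length3 p → Length3 (applySyms w p)
symmetries-length3 [] p p₃ = p₃
symmetries-length3 (s ∷ w) p p₃ = symmetry-length3 s _ (symmetries-length3 w p p₃)

symmetries-count : ∀ {n m} w p → Length3 p → NumAvoiders p n m → NumAvoiders (applySyms w p) n m
symmetries-count [] p p₃ count = count
symmetries-count (s ∷ w) p p₃ count =
  symmetry-count s _ (symmetries-length3 w p p₃) (symmetries-count w p p₃ count)

cons : ∀ {n} → Fin (suc n) → Perm n → Perm (suc n)
cons i σ = i ∷ᵥ V.map (punchIn i) σ

allPerms : ∀ n → List (Perm n)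
allPerms zero = []ᵥ ∷ []
allPerms (suc n) = cartesianProductWith cons (allFin (suc n)) (allPerms n)

cons-lookup : ∀ {n} (i : Fin (suc n)) (σ : Perm n) j → lookup (cons i σ) (F.suc j) ≡ punchIn i (lookup σ j)
cons-lookup i σ j = VP.lookup-map j (punchIn i) σ

cons-injective : ∀ {n} {i j : Fin (suc n)} {σ τ : Perm n} → cons i σ ≡ cons j τ → i ≡ j × σ ≡ τ
cons-injective {i = i} {σ = σ} {τ} eq with cong (λ π → lookup π 0F) eq
... | refl = refl , lookup-extensionality σ τ λ k → FP.punchIn-injective i _ _
  (trans (sym (cons-lookup i σ k)) (trans (cong (λ π → lookup π (F.suc k)) eq) (cons-lookup i τ k)))

cons-perm : ∀ {n} (i : Fin (suc n)) (σ : Perm n) → IsPerm σ → IsPerm (cons i σ)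
cons-perm i σ σ-perm 0F 0F eq = refl
cons-perm i σ σ-perm 0F (F.suc b) eq = ⊥-elim (FP.punchInᵢ≢i i (lookup σ b) (sym (trans eq (cons-lookup i σ b))))
cons-perm i σ σ-perm (F.suc a) 0F eq = ⊥-elim (FP.punchInᵢ≢i i (lookup σ a) (trans (sym (cons-lookup i σ a)) eq))
cons-perm i σ σ-perm (F.suc a) (F.suc b) eq = cong F.suc (σ-perm a b (FP.punchIn-injective i _ _
  (trans (sym (cons-lookup i σ a)) (trans eq (cons-lookup i σ b)))))

decompose : ∀ {n} (π : Perm (suc n)) → IsPerm π → ∃[ rest ] (IsPerm rest × π ≡ cons (lookup π 0F) rest)
decompose {n} π π-perm = rest , rest-perm , lookup-extensionality _ _ π≗
  where
  first≢ : ∀ j → lookup π 0F ≢ lookup π (F.suc j)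
  first≢ j eq with π-perm _ _ eq
  ... | ()
  rest : Perm n
  rest = tabulate (λ j → punchOut (first≢ j))
  rest-lookup : ∀ j → lookup rest j ≡ punchOut (first≢ j)
  rest-lookup = VP.lookup∘tabulate _
  rest-perm : IsPerm rest
  rest-perm a b eq = FP.suc-injective (π-perm _ _ (FP.punchOut-injective (first≢ a) (first≢ b)
    (trans (sym (rest-lookup a)) (trans eq (rest-lookup b)))))
  π≗ : ∀ j → lookup π j ≡ lookup (cons (lookup π 0F) rest) j
  π≗ 0F = refl
  π≗ (F.suc j) = sym (trans (cons-lookup _ rest j) (trans (cong (punchIn _) (rest-lookup j)) (FP.punchIn-punchOut (first≢ j))))

allPerms-perm : ∀ n {π} → π ∈ allPerms n → IsPerm π
allPerms-perm zero {[]ᵥ} _ ()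
allPerms-perm (suc n) π∈ with MP.∈-cartesianProductWith⁻ cons (allFin (suc n)) (allPerms n) π∈
... | i , σ , _ , σ∈ , refl = cons-perm i σ (allPerms-perm n σ∈)

perm∈allPerms : ∀ n (π : Perm n) → IsPerm π → π ∈ allPerms n
perm∈allPerms zero []ᵥ _ = here refl
perm∈allPerms (suc n) π π-perm with decompose π π-perm
... | σ , σ-perm , eq = subst (_∈ allPerms (suc n)) (sym eq)
  (MP.∈-cartesianProductWith⁺ cons (MP.∈-allFin _) (perm∈allPerms n σ σ-perm))

allPerms-unique : ∀ n → Unique (allPerms n)
allPerms-unique zero = [] ∷ []
allPerms-unique (suc n) = UP.cartesianProductWith⁺ cons cons-injective (UP.allFin⁺ (suc n)) (allPerms-unique n)

length-cartesianProductWith : ∀ {A B C : Set} (f : A → B → C) xs ys →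
  length (cartesianProductWith f xs ys) ≡ length xs * length ys
length-cartesianProductWith f [] ys = refl
length-cartesianProductWith f (x ∷ xs) ys = trans (LP.length-++ (map (f x) ys))
  (cong₂ _+_ (LP.length-map (f x) ys) (length-cartesianProductWith f xs ys))

allPerms-length : ∀ n → length (allPerms n) ≡ n !
allPerms-length zero = refl
allPerms-length (suc n) = trans (length-cartesianProductWith cons (allFin (suc n)) (allPerms n))
  (cong₂ _*_ (LP.length-tabulate {n = suc n} (λ i → i)) (allPerms-length n))

unique-length : ∀ {A : Set} {xs ys : List A} → Unique xs → Unique ys →
  (∀ {x} → x ∈ xs ⇔ x ∈ ys) → length xs ≡ length ys
unique-length xs-unique ys-unique same = ↭-length (∼bag⇒↭ (unique∧set⇒bag xs-unique ys-unique same))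

count : ∀ {A : Set} {P : A → Set} → Decidable P → List A → ℕ
count P? xs = length (filter P? xs)

count-as-length : ∀ {A : Set} {P : A → Set} (P? : Decidable P) (xs ys : List A) → Unique xs → Unique ys →
  (∀ y → y ∈ ys ⇔ (y ∈ xs × P y)) → count P? xs ≡ length ys
count-as-length P? xs ys xs-unique ys-unique members =
  unique-length (UP.filter⁺ P? xs-unique) ys-unique λ {y} →
    mk⇔ (λ y∈ → let (y∈xs , Py) = MP.∈-filter⁻ P? y∈ in bwd (members y) (y∈xs , Py))
        (λ y∈ → let (y∈xs , Py) = fwd (members y) y∈ in MP.∈-filter⁺ P? y∈xs Py)

count-refine : ∀ {A : Set} {P Q : A → Set} (P? : Decidable P) (Q? : Decidable Q) xs →
  count P? xs ≡ count (λ x → P? x ×-dec Q? x) xs + count (λ x → P? x ×-dec ¬? (Q? x)) xs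
count-refine P? Q? [] = refl
count-refine P? Q? (x ∷ xs) with ih ← count-refine P? Q? xs | P? x | Q? x
... | yes _ | yes _ = cong suc ih
... | yes _ | no _ = trans (cong suc ih) (sym (NP.+-suc _ _))
... | no _ | _ = ih

count-complement : ∀ {A : Set} {P : A → Set} (P? : Decidable P) xs →
  count P? xs + count (λ x → ¬? (P? x)) xs ≡ length xs
count-complement P? [] = refl
count-complement P? (x ∷ xs) with ih ← count-complement P? xs | P? x
... | yes _ = cong suc ih
... | no _ = trans (NP.+-suc _ _) (cong suc ih)

count-parametrised : ∀ {n k} {P : Perm k → Set} (P? : Decidable P) (f : Perm n → Perm k) →
  (∀ {σ τ} → f σ ≡ f τ → σ ≡ τ) → (∀ σ → IsPerm σ → IsPerm (f σ) × P (f σ)) →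
  (∀ π → IsPerm π → P π → ∃[ σ ] (IsPerm σ × π ≡ f σ)) → count P? (allPerms k) ≡ n !
count-parametrised {n} {k} {P} P? f f-injective sound complete =
  trans (count-as-length P? (allPerms k) (map f (allPerms n)) (allPerms-unique k)
          (UP.map⁺ f-injective (allPerms-unique n)) members)
    (trans (LP.length-map f (allPerms n)) (allPerms-length n))
  where
  members : ∀ π → π ∈ map f (allPerms n) ⇔ (π ∈ allPerms k × P π)
  members π = mk⇔
    (λ π∈ → let (σ , σ∈ , π≡) = MP.∈-map⁻ f π∈
                (fσ-perm , P-fσ) = sound σ (allPerms-perm n σ∈) in
            subst (λ ρ → ρ ∈ allPerms k × P ρ) (sym π≡) (perm∈allPerms k (f σ) fσ-perm , P-fσ))
    (λ (π∈ , Pπ) → let (σ , σ-perm , π≡) = complete π (allPerms-perm k π∈) Pπ in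
            subst (_∈ map f (allPerms n)) (sym π≡) (MP.∈-map⁺ f (perm∈allPerms n σ σ-perm)))

count-by-involution : ∀ {n} {P Q : Perm n → Set} (P? : Decidable P) (Q? : Decidable Q) (φ : Involution n) →
  (∀ π → IsPerm π → P π ⇔ Q (apply φ π)) → count P? (allPerms n) ≡ count Q? (allPerms n)
count-by-involution {n} {P} {Q} P? Q? φ P⇔Qφ =
  trans (count-as-length P? (allPerms n) (map (apply φ) Qs) (allPerms-unique n)
          (map-unique (apply φ) (UP.filter⁺ Q? (allPerms-unique n)) injective) members)
    (LP.length-map (apply φ) Qs)
  where
  Qs : List (Perm n)
  Qs = filter Q? (allPerms n)
  perm : ∀ {π} → π ∈ Qs → IsPerm π
  perm π∈ = allPerms-perm n (proj₁ (MP.∈-filter⁻ Q? {xs = allPerms n} π∈))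
  injective : ∀ {x y} → x ∈ Qs → y ∈ Qs → apply φ x ≡ apply φ y → x ≡ y
  injective {x} {y} x∈ y∈ eq =
    trans (sym (involutive φ x (perm x∈))) (trans (cong (apply φ) eq) (involutive φ y (perm y∈)))
  members : ∀ π → π ∈ map (apply φ) Qs ⇔ (π ∈ allPerms n × P π)
  members π = mk⇔
    (λ π∈ → let (σ , σ∈ , π≡) = MP.∈-map⁻ (apply φ) π∈
                (_ , Qσ) = MP.∈-filter⁻ Q? {xs = allPerms n} σ∈
                φσ-perm = preserves φ σ (perm σ∈) in
            subst (λ ρ → ρ ∈ allPerms n × P ρ) (sym π≡) (perm∈allPerms n _ φσ-perm ,
              bwd (P⇔Qφ _ φσ-perm) (subst Q (sym (involutive φ σ (perm σ∈))) Qσ)))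
    (λ (π∈ , Pπ) → let π-perm = allPerms-perm n π∈ in
            subst (_∈ map (apply φ) Qs) (involutive φ π π-perm)
              (MP.∈-map⁺ (apply φ) (MP.∈-filter⁺ Q? (perm∈allPerms n _ (preserves φ π π-perm)) (fwd (P⇔Qφ π π-perm) Pπ))))

transpose-left : ∀ {n} (a b : Fin n) → transpose a b a ≡ b
transpose-left a b with a FP.≟ a
... | yes _ = refl
... | no a≢a = ⊥-elim (a≢a refl)

transpose-right : ∀ {n} (a b : Fin n) → transpose a b b ≡ a
transpose-right a b with b FP.≟ a
... | yes b≡a = b≡a
... | no _ with b FP.≟ b
...   | yes _ = refl
...   | no b≢b = ⊥-elim (b≢b refl)

transpose-other : ∀ {n} (a b i : Fin n) → i ≢ a → i ≢ b → transpose a b i ≡ i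
transpose-other a b i i≢a i≢b with i FP.≟ a
... | yes i≡a = ⊥-elim (i≢a i≡a)
... | no _ with i FP.≟ b
...   | yes i≡b = ⊥-elim (i≢b i≡b)
...   | no _ = refl

transpose-involutive : ∀ {n} (a b i : Fin n) → transpose a b (transpose a b i) ≡ i
transpose-involutive a b i with i FP.≟ a
... | yes refl = transpose-right i b
... | no i≢a with i FP.≟ b
...   | yes refl = transpose-left a i
...   | no i≢b = transpose-other a b i i≢a i≢b

transpose-injective : ∀ {n} (a b : Fin n) {i j} → transpose a b i ≡ transpose a b j → i ≡ j
transpose-injective a b {i} {j} eq =
  trans (sym (transpose-involutive a b i)) (trans (cong (transpose a b) eq) (transpose-involutive a b j))

swap : ∀ {n} → Fin n → Fin n → Perm n → Perm n
swap a b π = tabulate (λ i → lookup π (transpose a b i))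

swap-lookup : ∀ {n} (a b : Fin n) π i → lookup (swap a b π) i ≡ lookup π (transpose a b i)
swap-lookup a b π = VP.lookup∘tabulate _

swap-left : ∀ {n} (a b : Fin n) π → lookup (swap a b π) a ≡ lookup π b
swap-left a b π = trans (swap-lookup a b π a) (cong (lookup π) (transpose-left a b))

swap-right : ∀ {n} (a b : Fin n) π → lookup (swap a b π) b ≡ lookup π a
swap-right a b π = trans (swap-lookup a b π b) (cong (lookup π) (transpose-right a b))

swap-other : ∀ {n} (a b i : Fin n) π → i ≢ a → i ≢ b → lookup (swap a b π) i ≡ lookup π i
swap-other a b i π i≢a i≢b = trans (swap-lookup a b π i) (cong (lookup π) (transpose-other a b i i≢a i≢b))

swap-relabel : ∀ {n} (a b : Fin n) π q → lookup (swap a b π) (transpose a b q) ≡ lookup π q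
swap-relabel a b π q = trans (swap-lookup a b π _) (cong (lookup π) (transpose-involutive a b q))

swap-involution : ∀ {n} (a b : Fin n) → Involution n
swap-involution a b = record
  { apply = swap a b
  ; preserves = λ π π-perm i j eq → transpose-injective a b (π-perm _ _
      (trans (sym (swap-lookup a b π i)) (trans eq (swap-lookup a b π j))))
  ; involutive = λ π _ → lookup-extensionality _ _ λ i →
      trans (swap-lookup a b (swap a b π) i) (swap-relabel a b π i)
  }

-- Exchanging two entries and complementing: an involution that reverses the
-- order of values, used to flip "above" into "below".
complement-swap-involution : ∀ {n} (a b : Fin n) → Involution n
complement-swap-involution a b = record
  { apply = λ π → complement (swap a b π)
  ; preserves = λ π π-perm → preserves complement-involution (swap a b π) (preserves (swap-involution a b) π π-perm)
  ; involutive = λ π _ → lookup-extensionality _ _ λ i → begin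
      lookup (complement (swap a b (complement (swap a b π)))) i
        ≡⟨ complement-lookup (swap a b (complement (swap a b π))) i ⟩
      opposite (lookup (swap a b (complement (swap a b π))) i)
        ≡⟨ cong opposite (swap-lookup a b (complement (swap a b π)) i) ⟩
      opposite (lookup (complement (swap a b π)) (transpose a b i))
        ≡⟨ cong opposite (complement-lookup (swap a b π) (transpose a b i)) ⟩
      opposite (opposite (lookup (swap a b π) (transpose a b i)))
        ≡⟨ FP.opposite-involutive _ ⟩
      lookup (swap a b π) (transpose a b i)
        ≡⟨ swap-relabel a b π i ⟩
      lookup π i ∎
  }
  where open ≡-Reasoning

-- Events in S_n and their sizes

-- The entry at position q is the smallest value 1.
Smallest : ∀ {n} → Fin n → Perm n → Set
Smallest q π = toℕ (lookup π q) ≡ 0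

smallest? : ∀ {n} (q : Fin n) → Decidable (Smallest q)
smallest? q π = toℕ (lookup π q) ≟ 0

Consecutive : ∀ {n} → Fin n → Fin n → Perm n → Set
Consecutive q₀ q₁ π = toℕ (lookup π q₁) ≡ suc (toℕ (lookup π q₀))

consecutive? : ∀ {n} (q₀ q₁ : Fin n) → Decidable (Consecutive q₀ q₁)
consecutive? q₀ q₁ π = toℕ (lookup π q₁) ≟ suc (toℕ (lookup π q₀))

Below : ∀ {n} → Fin n → Fin n → Perm n → Set
Below q₁ q₂ π = toℕ (lookup π q₁) < toℕ (lookup π q₂)

below? : ∀ {n} (q₁ q₂ : Fin n) → Decidable (Below q₁ q₂)
below? q₁ q₂ π = toℕ (lookup π q₁) <? toℕ (lookup π q₂)

perm-distinct : ∀ {n} (π : Perm n) → IsPerm π → ∀ {a b} → a ≢ b → toℕ (lookup π a) ≢ toℕ (lookup π b)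
perm-distinct π π-perm a≢b eq = a≢b (π-perm _ _ (FP.toℕ-injective eq))

first-smallest-count : ∀ n → count (smallest? 0F) (allPerms (suc n)) ≡ n !
first-smallest-count n = count-parametrised {n = n} (smallest? 0F) (cons 0F) (proj₂ ∘ cons-injective)
  (λ σ σ-perm → cons-perm 0F σ σ-perm , refl)
  (λ π π-perm π0≡0 → let (σ , σ-perm , π≡) = decompose π π-perm in
     σ , σ-perm , trans π≡ (cong (λ i → cons i σ) (FP.toℕ-injective {j = 0F} π0≡0)))

punchIn-self : ∀ {n} (j : Fin n) → toℕ (punchIn (inject₁ j) j) ≡ suc (toℕ (inject₁ j))
punchIn-self 0F = refl
punchIn-self (F.suc j) = cong suc (punchIn-self j)

punchIn-successor : ∀ {n} (i : Fin (suc n)) (j : Fin n) → toℕ (punchIn i j) ≡ suc (toℕ i) → toℕ j ≡ toℕ i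
punchIn-successor 0F j eq = NP.suc-injective eq
punchIn-successor (F.suc i) 0F ()
punchIn-successor (F.suc i) (F.suc j) eq = cong suc (punchIn-successor i j (NP.suc-injective eq))

-- Merging the first two values: |{π ∈ S_{n+2} : π(2) = π(1) + 1}| = (n+1)!,
-- as such π are σ ∈ S_{n+1} with its first value doubled.
first-consecutive-count : ∀ n → count (consecutive? 0F 1F) (allPerms (suc (suc n))) ≡ (suc n) !
first-consecutive-count n = count-parametrised {n = suc n} (consecutive? 0F 1F) double
  (proj₂ ∘ cons-injective) sound complete
  where
  double : Perm (suc n) → Perm (suc (suc n))
  double σ = cons (inject₁ (lookup σ 0F)) σ
  sound : ∀ σ → IsPerm σ → IsPerm (double σ) × Consecutive 0F 1F (double σ)
  sound σ σ-perm = cons-perm _ σ σ-perm , trans (cong toℕ (cons-lookup _ σ 0F)) (punchIn-self (lookup σ 0F))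
  complete : ∀ π → IsPerm π → Consecutive 0F 1F π → ∃[ σ ] (IsPerm σ × π ≡ double σ)
  complete π π-perm adj with decompose π π-perm
  ... | σ , σ-perm , π≡ = σ , σ-perm , trans π≡ (cong (λ i → cons i σ) first≡)
    where
    second : toℕ (punchIn (lookup π 0F) (lookup σ 0F)) ≡ suc (toℕ (lookup π 0F))
    second = trans (sym (cong toℕ (trans (cong (λ ρ → lookup ρ 1F) π≡) (cons-lookup _ σ 0F)))) adj
    first≡ : lookup π 0F ≡ inject₁ (lookup σ 0F)
    first≡ = FP.toℕ-injective (trans (sym (punchIn-successor _ _ second)) (sym (FP.toℕ-inject₁ _)))

-- |{π ∈ S_{n+1} : π(q) = 1}| = n!, moving q to the front.
smallest-count : ∀ n (q : Fin (suc n)) → count (smallest? q) (allPerms (suc n)) ≡ n !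
smallest-count n q = trans
  (count-by-involution (smallest? q) (smallest? 0F) (swap-involution 0F q)
     λ π _ → ≡⇒⇔ (λ v → toℕ v ≡ 0) (sym (swap-left 0F q π)))
  (first-smallest-count n)

-- |{π ∈ S_{n+2} : π(q₁) = π(q₀) + 1}| = (n+1)! for q₀ ≠ q₁, moving q₀, q₁
-- to the first two positions by two exchanges.
consecutive-count : ∀ n (q₀ q₁ : Fin (suc (suc n))) → q₀ ≢ q₁ →
  count (consecutive? q₀ q₁) (allPerms (suc (suc n))) ≡ (suc n) !
consecutive-count n q₀ q₁ q₀≢q₁ = trans step₀ (trans step₁ (first-consecutive-count n))
  where
  q₁' : Fin (suc (suc n))
  q₁' = transpose 0F q₀ q₁
  q₁'≢0 : q₁' ≢ 0F
  q₁'≢0 eq = q₀≢q₁ (transpose-injective 0F q₀ (trans (transpose-right 0F q₀) (sym eq)))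
  Consecutive′ : Fin (suc (suc n)) → Fin (suc (suc n)) → Set
  Consecutive′ u v = toℕ v ≡ suc (toℕ u)
  step₀ : count (consecutive? q₀ q₁) (allPerms (suc (suc n))) ≡ count (consecutive? 0F q₁') (allPerms (suc (suc n)))
  step₀ = count-by-involution _ _ (swap-involution 0F q₀) λ π _ →
    ≡₂⇒⇔ Consecutive′ (sym (swap-left 0F q₀ π)) (sym (swap-relabel 0F q₀ π q₁))
  step₁ : count (consecutive? 0F q₁') (allPerms (suc (suc n))) ≡ count (consecutive? 0F 1F) (allPerms (suc (suc n)))
  step₁ = count-by-involution _ _ (swap-involution 1F q₁') λ π _ →
    ≡₂⇒⇔ Consecutive′ (sym (swap-other 1F q₁' 0F π (λ ()) (q₁'≢0 ∘ sym))) (sym (swap-left 1F q₁' π))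

-- Half of the permutations with π(q₀) = 1 have π(q₁) < π(q₂): exchanging
-- the entries at q₁ and q₂ matches them with the other half.
smallest-below-count : ∀ n (q₀ q₁ q₂ : Fin (suc n)) → q₀ ≢ q₁ → q₀ ≢ q₂ → q₁ ≢ q₂ →
  let c = count (λ π → smallest? q₀ π ×-dec below? q₁ q₂ π) (allPerms (suc n)) in c + c ≡ n !
smallest-below-count n q₀ q₁ q₂ q₀≢q₁ q₀≢q₂ q₁≢q₂ =
  trans (cong (count (λ π → smallest? q₀ π ×-dec below? q₁ q₂ π) (allPerms (suc n)) +_) (sym other-half))
    (trans (sym (count-refine (smallest? q₀) (below? q₁ q₂) (allPerms (suc n)))) (smallest-count n q₀))
  where
  other-half : count (λ π → smallest? q₀ π ×-dec ¬? (below? q₁ q₂ π)) (allPerms (suc n))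
             ≡ count (λ π → smallest? q₀ π ×-dec below? q₁ q₂ π) (allPerms (suc n))
  other-half = count-by-involution _ _ (swap-involution q₁ q₂) λ π π-perm →
    let at-q₀ = sym (swap-other q₁ q₂ q₀ π q₀≢q₁ q₀≢q₂)
        q₁-q₂ = ≡₂⇒⇔ (λ u v → toℕ u < toℕ v) (sym (swap-left q₁ q₂ π)) (sym (swap-right q₁ q₂ π)) in
    mk⇔ (λ (z , nb) → fwd (≡⇒⇔ (λ v → toℕ v ≡ 0) at-q₀) z , fwd q₁-q₂ (fwd (not-below (perm-distinct π π-perm q₁≢q₂)) nb))
        (λ (z , b) → bwd (≡⇒⇔ (λ v → toℕ v ≡ 0) at-q₀) z , bwd (not-below (perm-distinct π π-perm q₁≢q₂)) (bwd q₁-q₂ b))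

-- Half of the permutations with π(q₁) = π(q₀) + 1 have π(q₁) < π(q₂):
-- exchanging the entries at q₀, q₁ and complementing matches the halves.
consecutive-below-count : ∀ n (q₀ q₁ q₂ : Fin (suc (suc n))) → q₀ ≢ q₁ → q₀ ≢ q₂ → q₁ ≢ q₂ →
  let c = count (λ π → consecutive? q₀ q₁ π ×-dec below? q₁ q₂ π) (allPerms (suc (suc n))) in c + c ≡ (suc n) !
consecutive-below-count n q₀ q₁ q₂ q₀≢q₁ q₀≢q₂ q₁≢q₂ =
  trans (cong (count (λ π → consecutive? q₀ q₁ π ×-dec below? q₁ q₂ π) (allPerms (suc (suc n))) +_) (sym other-half))
    (trans (sym (count-refine (consecutive? q₀ q₁) (below? q₁ q₂) (allPerms (suc (suc n)))))
      (consecutive-count n q₀ q₁ q₀≢q₁))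
  where
  ψ : Involution (suc (suc n))
  ψ = complement-swap-involution q₀ q₁
  at : ∀ π i j → lookup (swap q₀ q₁ π) i ≡ lookup π j → lookup (apply ψ π) i ≡ opposite (lookup π j)
  at π i j eq = trans (complement-lookup (swap q₀ q₁ π) i) (cong opposite eq)
  matched : ∀ π → IsPerm π → (Consecutive q₀ q₁ π × ¬ Below q₁ q₂ π) ⇔ (Consecutive q₀ q₁ (apply ψ π) × Below q₁ q₂ (apply ψ π))
  matched π π-perm = mk⇔
    (λ (adj , nb) → fwd consecutive⇔ adj , fwd below⇔ (fwd (below-consecutive adj q₂≢q₀) (fwd (not-below q₁≢q₂′) nb)))
    (λ (adj , b) → let adj′ = bwd consecutive⇔ adj in
      adj′ , bwd (not-below q₁≢q₂′) (bwd (below-consecutive adj′ q₂≢q₀) (bwd below⇔ b)))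
    where
    at-q₀ : lookup (apply ψ π) q₀ ≡ opposite (lookup π q₁)
    at-q₀ = at π q₀ q₁ (swap-left q₀ q₁ π)
    at-q₁ : lookup (apply ψ π) q₁ ≡ opposite (lookup π q₀)
    at-q₁ = at π q₁ q₀ (swap-right q₀ q₁ π)
    at-q₂ : lookup (apply ψ π) q₂ ≡ opposite (lookup π q₂)
    at-q₂ = at π q₂ q₂ (swap-other q₀ q₁ q₂ π (q₀≢q₂ ∘ sym) (q₁≢q₂ ∘ sym))
    q₁≢q₂′ : toℕ (lookup π q₁) ≢ toℕ (lookup π q₂)
    q₁≢q₂′ = perm-distinct π π-perm q₁≢q₂
    q₂≢q₀ : toℕ (lookup π q₂) ≢ toℕ (lookup π q₀)
    q₂≢q₀ = perm-distinct π π-perm (q₀≢q₂ ∘ sym)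
    consecutive⇔ : Consecutive q₀ q₁ π ⇔ Consecutive q₀ q₁ (apply ψ π)
    consecutive⇔ = ≡₂⇒⇔ (λ u v → toℕ v ≡ suc (toℕ u)) (sym at-q₀) (sym at-q₁)
      ⇔-∘ opposite-consecutive (lookup π q₀) (lookup π q₁)
    below⇔ : toℕ (lookup π q₂) < toℕ (lookup π q₀) ⇔ Below q₁ q₂ (apply ψ π)
    below⇔ = ≡₂⇒⇔ (λ u v → toℕ u < toℕ v) (sym at-q₁) (sym at-q₂) ⇔-∘ opposite-iff (lookup π q₂) (lookup π q₀)
  other-half : count (λ π → consecutive? q₀ q₁ π ×-dec ¬? (below? q₁ q₂ π)) (allPerms (suc (suc n)))
             ≡ count (λ π → consecutive? q₀ q₁ π ×-dec below? q₁ q₂ π) (allPerms (suc (suc n)))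
  other-half = count-by-involution _ _ ψ matched

-- Canonical patterns

-- Position sets X that pin every occurrence to fixed places: the positions
-- 1,2,3 (X = {0,1,2}) or 1,2,n (X = {0,1,3}), each listed in two orders.
data Anchored : List ℕ → Set where
  at-1-2-3 : Anchored (0 ∷ 1 ∷ 2 ∷ [])
  at-3-2-1 : Anchored (2 ∷ 1 ∷ 0 ∷ [])
  at-1-2-n : Anchored (0 ∷ 1 ∷ 3 ∷ [])
  at-n-2-1 : Anchored (3 ∷ 1 ∷ 0 ∷ [])

-- The value sets Y of canonical patterns: the smallest value of an
-- occurrence is 1, resp. its two smallest values are consecutive.
data ValueCondition : List ℕ → Set where
  smallest-is-1 : ValueCondition (0 ∷ [])
  smallest-consecutive : ValueCondition (1 ∷ [])

bounded : (X : List ℕ) → {True (All.all? (_≤? 3) X)} → All (_≤ 3) X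
bounded X {X≤3} = toWitness X≤3

canonical-length3 : ∀ {τ X Y} → IsPerm3 τ → Anchored X → ValueCondition Y → Length3 (bv 3 τ X Y)
canonical-length3 τ₃ A V = length3 τ₃ (anchored-bounded A) (condition-bounded V)
  where
  anchored-bounded : ∀ {X} → Anchored X → All (_≤ 3) X
  anchored-bounded at-1-2-3 = bounded _
  anchored-bounded at-3-2-1 = bounded _
  anchored-bounded at-1-2-n = bounded _
  anchored-bounded at-n-2-1 = bounded _
  condition-bounded : ∀ {Y} → ValueCondition Y → All (_≤ 3) Y
  condition-bounded smallest-is-1 = bounded _
  condition-bounded smallest-consecutive = bounded _

half-of-double : ∀ {c f} → c + c ≡ f → f / 2 ≡ c
half-of-double {c} eq = trans (cong (_/ 2) (sym (trans (NP.*-comm c 2) (trans (cong (c +_) (NP.+-identityʳ c)) eq))))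
  (m*n/n≡m c 2)

avoiders-count : ∀ h (p : BiVincular) {Φ : Perm (suc h) → Set} (Φ? : Decidable Φ) →
  count Φ? (allPerms (suc h)) + count Φ? (allPerms (suc h)) ≡ h ! →
  (∀ π → IsPerm π → Contains p π ⇔ Φ π) → NumAvoiders p (suc h) (suc h ! ∸ (h ! / 2))
avoiders-count h p {Φ} Φ? halving contains⇔ =
  filter ¬Φ? (allPerms (suc h)) , UP.filter⁺ ¬Φ? (allPerms-unique (suc h)) ,
  (λ π → mk⇔ (member⇒ π) (⇒member π)) , length≡
  where
  ¬Φ? : Decidable (λ π → ¬ Φ π)
  ¬Φ? π = ¬? (Φ? π)
  member⇒ : ∀ π → π ∈ filter ¬Φ? (allPerms (suc h)) → IsPerm π × Avoids p π
  member⇒ π π∈ with MP.∈-filter⁻ ¬Φ? π∈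
  ... | π∈all , ¬Φπ = allPerms-perm (suc h) π∈all , λ c → ¬Φπ (fwd (contains⇔ π (allPerms-perm (suc h) π∈all)) c)
  ⇒member : ∀ π → IsPerm π × Avoids p π → π ∈ filter ¬Φ? (allPerms (suc h))
  ⇒member π (π-perm , avoids) = MP.∈-filter⁺ ¬Φ? (perm∈allPerms (suc h) π π-perm) (avoids ∘ bwd (contains⇔ π π-perm))
  c : ℕ
  c = count Φ? (allPerms (suc h))
  length≡ : count ¬Φ? (allPerms (suc h)) ≡ suc h ! ∸ (h ! / 2)
  length≡ = trans (sym (NP.m+n∸m≡n c (count ¬Φ? (allPerms (suc h)))))
    (cong₂ _∸_ (trans (count-complement Φ? (allPerms (suc h))) (allPerms-length (suc h))) (sym (half-of-double {c} {h !} halving)))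

module Canonical (m : ℕ) where

  N : ℕ
  N = suc (suc (suc m))

  PositionsAdjacent : List ℕ → (Fin 3 → Fin N) → Set
  PositionsAdjacent X ι = ∀ x → x ∈ X → ext 3 N (λ a → suc (toℕ (ι a))) (suc x) ≡ suc (ext 3 N (λ a → suc (toℕ (ι a))) x)

  Pins : List ℕ → (Fin 3 → Fin N) → Set
  Pins X P = (∀ ι → Increasing (toℕ ∘ ι) → PositionsAdjacent X ι → ∀ a → ι a ≡ P a)
           × PositionsAdjacent X P × Increasing (toℕ ∘ P)

  first-three : Fin 3 → Fin N
  first-three 0F = 0F
  first-three 1F = 1F
  first-three 2F = 2F

  first-two-last : Fin 3 → Fin N
  first-two-last 0F = 0F
  first-two-last 1F = 1F
  first-two-last 2F = F.fromℕ (suc (suc m))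

  pins-first-three : ∀ X → 0 ∈ X → 1 ∈ X → 2 ∈ X → All (_≤ 2) X → Pins X first-three
  pins-first-three X 0∈ 1∈ 2∈ X≤2 = forced , adjacent , Fin3-increasing
    where
    forced : ∀ ι → Increasing (toℕ ∘ ι) → PositionsAdjacent X ι → ∀ a → ι a ≡ first-three a
    forced ι _ adj = Fin3-elim _ (FP.toℕ-injective ι0) (FP.toℕ-injective ι1) (FP.toℕ-injective ι2)
      where
      ι0 : toℕ (ι 0F) ≡ 0
      ι0 = NP.suc-injective (adj 0 0∈)
      ι1 : toℕ (ι 1F) ≡ 1
      ι1 = trans (NP.suc-injective (adj 1 1∈)) (cong suc ι0)
      ι2 : toℕ (ι 2F) ≡ 2
      ι2 = trans (NP.suc-injective (adj 2 2∈)) (cong suc ι1)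
    adjacent : PositionsAdjacent X first-three
    adjacent x x∈ with All.lookup X≤2 x∈
    ... | z≤n = refl
    ... | s≤s z≤n = refl
    ... | s≤s (s≤s z≤n) = refl
    Fin3-increasing : Increasing (toℕ ∘ first-three)
    Fin3-increasing = increasing₃ (toℕ ∘ first-three) (s≤s z≤n) (s≤s (s≤s z≤n))

  last≡ : toℕ (F.fromℕ (suc (suc m))) ≡ suc (suc m)
  last≡ = FP.toℕ-fromℕ (suc (suc m))

  pins-first-two-last : ∀ X → 0 ∈ X → 1 ∈ X → 3 ∈ X → All (λ x → x ≡ 0 ⊎ x ≡ 1 ⊎ x ≡ 3) X → Pins X first-two-last
  pins-first-two-last X 0∈ 1∈ 3∈ X⊆013 = forced , adjacent , increasing
    where
    forced : ∀ ι → Increasing (toℕ ∘ ι) → PositionsAdjacent X ι → ∀ a → ι a ≡ first-two-last a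
    forced ι _ adj = Fin3-elim _ (FP.toℕ-injective ι0) (FP.toℕ-injective ι1) (FP.toℕ-injective (trans ι2 (sym last≡)))
      where
      ι0 : toℕ (ι 0F) ≡ 0
      ι0 = NP.suc-injective (adj 0 0∈)
      ι1 : toℕ (ι 1F) ≡ 1
      ι1 = trans (NP.suc-injective (adj 1 1∈)) (cong suc ι0)
      ι2 : toℕ (ι 2F) ≡ suc (suc m)
      ι2 = NP.suc-injective (NP.suc-injective (sym (adj 3 3∈)))
    adjacent : PositionsAdjacent X first-two-last
    adjacent x x∈ with All.lookup X⊆013 x∈
    ... | inj₁ refl = refl
    ... | inj₂ (inj₁ refl) = refl
    ... | inj₂ (inj₂ refl) = cong (suc ∘ suc) (sym last≡)
    increasing : Increasing (toℕ ∘ first-two-last)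
    increasing = increasing₃ (toℕ ∘ first-two-last) (s≤s z≤n) (subst (1 <_) (sym last≡) (s≤s (s≤s z≤n)))

  anchor : ∀ {X} → Anchored X → Fin 3 → Fin N
  anchor at-1-2-3 = first-three
  anchor at-3-2-1 = first-three
  anchor at-1-2-n = first-two-last
  anchor at-n-2-1 = first-two-last

  anchor-pins : ∀ {X} (A : Anchored X) → Pins X (anchor A)
  anchor-pins at-1-2-3 = pins-first-three _ (here refl) (there (here refl)) (there (there (here refl)))
    (z≤n ∷ s≤s z≤n ∷ s≤s (s≤s z≤n) ∷ [])
  anchor-pins at-3-2-1 = pins-first-three _ (there (there (here refl))) (there (here refl)) (here refl)
    (s≤s (s≤s z≤n) ∷ s≤s z≤n ∷ z≤n ∷ [])
  anchor-pins at-1-2-n = pins-first-two-last _ (here refl) (there (here refl)) (there (there (here refl)))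
    (inj₁ refl ∷ inj₂ (inj₁ refl) ∷ inj₂ (inj₂ refl) ∷ [])
  anchor-pins at-n-2-1 = pins-first-two-last _ (there (there (here refl))) (there (here refl)) (here refl)
    (inj₂ (inj₂ refl) ∷ inj₂ (inj₁ refl) ∷ inj₁ refl ∷ [])

  -- The position that carries the (r+1)-th smallest value of an occurrence
  -- of τ at the positions P.
  slot : Vec (Fin 3) 3 → (Fin 3 → Fin N) → Fin 3 → Fin N
  slot τ P r = P (lookup (invPerm τ) r)

  slot-injective : ∀ {τ} (P : Fin 3 → Fin N) → IsPerm3 τ → Increasing (toℕ ∘ P) →
    ∀ {r r'} → r ≢ r' → slot τ P r ≢ slot τ P r'
  slot-injective {τ} P τ₃ P-inc {r} {r'} r≢r' eq = r≢r' (trans (sym (invPerm-right τ₃ r))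
    (trans (cong (lookup τ) (increasing-injective P P-inc eq)) (invPerm-right τ₃ r')))

  module PinnedOccurrence {τ X} (Y : List ℕ) (τ₃ : IsPerm3 τ) (P : Fin 3 → Fin N) (pins : Pins X P)
                          (π : Perm N) where

    Q : Fin 3 → Fin N
    Q = slot τ P

    values : Fin 3 → ℕ
    values r = suc (toℕ (lookup π (Q r)))

    ValuesAdjacent : Set
    ValuesAdjacent = ∀ y → y ∈ Y → ext 3 N values (suc y) ≡ suc (ext 3 N values y)

    -- Any occurrence sits at P, so its value conditions are those of `values`.
    occurrence⇒ : Contains (bv 3 τ X Y) π → Below (Q 1F) (Q 2F) π × ValuesAdjacent
    occurrence⇒ (ι , ι-inc , iso , j , j-inc , js , X-adj , Y-adj) = Q1<Q2 , values-adjacent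
      where
      ι≡P : ∀ a → ι a ≡ P a
      ι≡P = proj₁ pins ι ι-inc X-adj
      j≡values : ∀ r → j r ≡ values r
      j≡values r = trans (sorted-values τ (invPerm τ) π ι j iso j-inc js (invPerm-left τ₃) r)
        (cong (λ z → suc (toℕ (lookup π z))) (ι≡P _))
      Q1<Q2 : Below (Q 1F) (Q 2F) π
      Q1<Q2 = subst₂ (λ a b → toℕ (lookup π a) < toℕ (lookup π b)) (ι≡P _) (ι≡P _)
        (fwd (iso _ _) (subst₂ (λ a b → toℕ a < toℕ b) (sym (invPerm-right τ₃ 1F)) (sym (invPerm-right τ₃ 2F)) (s≤s (s≤s z≤n))))
      values-adjacent : ValuesAdjacent
      values-adjacent y y∈ = trans (sym (ext-cong _ _ j≡values (suc y))) (trans (Y-adj y y∈) (cong suc (ext-cong _ _ j≡values y)))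

    ⇒occurrence : Below (Q 0F) (Q 1F) π → Below (Q 1F) (Q 2F) π → ValuesAdjacent → Contains (bv 3 τ X Y) π
    ⇒occurrence Q0<Q1 Q1<Q2 values-adjacent =
      P , proj₂ (proj₂ pins) , iso , values , (λ a b lt → s≤s (increasing a b lt)) , (λ r → lookup (invPerm τ) r , refl) ,
      proj₁ (proj₂ pins) , values-adjacent
      where
      increasing : Increasing (λ r → toℕ (lookup π (Q r)))
      increasing = increasing₃ _ Q0<Q1 Q1<Q2
      Qτ : ∀ a → Q (lookup τ a) ≡ P a
      Qτ a = cong P (invPerm-left τ₃ a)
      iso : OrderIso τ π P
      iso a b = subst₂ (λ x y → (toℕ (lookup τ a) < toℕ (lookup τ b)) ⇔ (toℕ (lookup π x) < toℕ (lookup π y))) (Qτ a) (Qτ b)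
        (increasing-iff _ increasing (lookup τ a) (lookup τ b))

  contains-smallest : ∀ {τ X} (τ₃ : IsPerm3 τ) (A : Anchored X) π → IsPerm π →
    Contains (bv 3 τ X (0 ∷ [])) π ⇔ (Smallest (slot τ (anchor A) 0F) π × Below (slot τ (anchor A) 1F) (slot τ (anchor A) 2F) π)
  contains-smallest τ₃ A π π-perm = mk⇔
    (λ c → let (Q1<Q2 , adj) = occurrence⇒ c in NP.suc-injective (adj 0 (here refl)) , Q1<Q2)
    (λ (Q0≡0 , Q1<Q2) → ⇒occurrence
      (subst (_< toℕ (lookup π (Q 1F))) (sym Q0≡0)
        (NP.n≢0⇒n>0 (λ Q1≡0 → perm-distinct π π-perm Q1≢Q0 (trans Q1≡0 (sym Q0≡0)))))
      Q1<Q2 λ { y (here refl) → cong suc Q0≡0 })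
    where
    open PinnedOccurrence (0 ∷ []) τ₃ (anchor A) (anchor-pins A) π
    Q1≢Q0 : Q 1F ≢ Q 0F
    Q1≢Q0 = slot-injective (anchor A) τ₃ (proj₂ (proj₂ (anchor-pins A))) {1F} {0F} (λ ())

  contains-consecutive : ∀ {τ X} (τ₃ : IsPerm3 τ) (A : Anchored X) π →
    Contains (bv 3 τ X (1 ∷ [])) π ⇔ (Consecutive (slot τ (anchor A) 0F) (slot τ (anchor A) 1F) π × Below (slot τ (anchor A) 1F) (slot τ (anchor A) 2F) π)
  contains-consecutive τ₃ A π = mk⇔
    (λ c → let (Q1<Q2 , adj) = occurrence⇒ c in NP.suc-injective (adj 1 (here refl)) , Q1<Q2)
    (λ (Q1≡1+Q0 , Q1<Q2) → ⇒occurrence (subst (toℕ (lookup π (Q 0F)) <_) (sym Q1≡1+Q0) (NP.n<1+n _))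
      Q1<Q2 λ { y (here refl) → cong suc Q1≡1+Q0 })
    where open PinnedOccurrence (1 ∷ []) τ₃ (anchor A) (anchor-pins A) π

  canonical-count : ∀ {τ X Y} → IsPerm3 τ → Anchored X → ValueCondition Y →
    NumAvoiders (bv 3 τ X Y) N (N ! ∸ ((N ∸ 1) ! / 2))
  canonical-count {τ} {X} τ₃ A smallest-is-1 = avoiders-count (suc (suc m)) (bv 3 τ X (0 ∷ []))
    (λ π → smallest? (Q 0F) π ×-dec below? (Q 1F) (Q 2F) π)
    (smallest-below-count (suc (suc m)) (Q 0F) (Q 1F) (Q 2F) (Q≢ {0F} {1F} (λ ())) (Q≢ {0F} {2F} (λ ())) (Q≢ {1F} {2F} (λ ())))
    (contains-smallest τ₃ A)
    where
    Q : Fin 3 → Fin N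
    Q = slot τ (anchor A)
    Q≢ : ∀ {r r'} → r ≢ r' → Q r ≢ Q r'
    Q≢ = slot-injective (anchor A) τ₃ (proj₂ (proj₂ (anchor-pins A)))
  canonical-count {τ} {X} τ₃ A smallest-consecutive = avoiders-count (suc (suc m)) (bv 3 τ X (1 ∷ []))
    (λ π → consecutive? (Q 0F) (Q 1F) π ×-dec below? (Q 1F) (Q 2F) π)
    (consecutive-below-count (suc m) (Q 0F) (Q 1F) (Q 2F) (Q≢ {0F} {1F} (λ ())) (Q≢ {0F} {2F} (λ ())) (Q≢ {1F} {2F} (λ ())))
    (λ π _ → contains-consecutive τ₃ A π)
    where
    Q : Fin 3 → Fin N
    Q = slot τ (anchor A)
    Q≢ : ∀ {r r'} → r ≢ r' → Q r ≢ Q r'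
    Q≢ = slot-injective (anchor A) τ₃ (proj₂ (proj₂ (anchor-pins A)))

data CanonicalImage : BiVincular → Set where
  image : ∀ w {τ X Y} → IsPerm3 τ → Anchored X → ValueCondition Y → CanonicalImage (applySyms w (bv 3 τ X Y))

-- The canonical preimage of each of the 24 base patterns, in the order of
-- the statement; each index is checked by evaluating the symmetries.
baseImages : All CanonicalImage basePatterns
baseImages =
    image (I ∷ []) ⟨123⟩ at-1-2-3 smallest-is-1
  ∷ image (I ∷ []) ⟨123⟩ at-1-2-n smallest-is-1
  ∷ image (I ∷ R ∷ []) ⟨321⟩ at-n-2-1 smallest-is-1
  ∷ image (I ∷ R ∷ []) ⟨321⟩ at-3-2-1 smallest-is-1
  ∷ image (I ∷ []) ⟨123⟩ at-1-2-3 smallest-consecutive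
  ∷ image (I ∷ []) ⟨123⟩ at-1-2-n smallest-consecutive
  ∷ image (I ∷ R ∷ []) ⟨321⟩ at-n-2-1 smallest-consecutive
  ∷ image (I ∷ R ∷ []) ⟨321⟩ at-3-2-1 smallest-consecutive
  ∷ image (I ∷ []) ⟨132⟩ at-1-2-3 smallest-is-1
  ∷ image (I ∷ []) ⟨132⟩ at-1-2-n smallest-is-1
  ∷ image (I ∷ R ∷ []) ⟨231⟩ at-n-2-1 smallest-is-1
  ∷ image (I ∷ R ∷ []) ⟨231⟩ at-3-2-1 smallest-is-1
  ∷ image (I ∷ []) ⟨132⟩ at-1-2-3 smallest-consecutive
  ∷ image (I ∷ []) ⟨132⟩ at-1-2-n smallest-consecutive
  ∷ image (I ∷ R ∷ []) ⟨231⟩ at-n-2-1 smallest-consecutive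
  ∷ image (I ∷ R ∷ []) ⟨231⟩ at-3-2-1 smallest-consecutive
  ∷ image (I ∷ C ∷ []) ⟨312⟩ at-1-2-3 smallest-consecutive
  ∷ image (I ∷ C ∷ []) ⟨312⟩ at-1-2-n smallest-consecutive
  ∷ image (I ∷ R ∷ C ∷ []) ⟨213⟩ at-n-2-1 smallest-consecutive
  ∷ image (I ∷ R ∷ C ∷ []) ⟨213⟩ at-3-2-1 smallest-consecutive
  ∷ image (C ∷ []) ⟨312⟩ at-1-2-3 smallest-is-1
  ∷ image (I ∷ C ∷ []) ⟨312⟩ at-1-2-n smallest-is-1
  ∷ image (I ∷ R ∷ C ∷ []) ⟨213⟩ at-n-2-1 smallest-is-1
  ∷ image (I ∷ R ∷ C ∷ []) ⟨213⟩ at-3-2-1 smallest-is-1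
  ∷ []

image-count : ∀ m {q} → CanonicalImage q →
  Length3 q × NumAvoiders q (3 + m) ((3 + m) ! ∸ ((2 + m) ! / 2))
image-count m (image w {τ} {X} {Y} τ₃ A V) =
  symmetries-length3 w _ canonical₃ , symmetries-count w _ canonical₃ (Canonical.canonical-count m τ₃ A V)
  where
  canonical₃ : Length3 (bv 3 τ X Y)
  canonical₃ = canonical-length3 τ₃ A V

mainTheorem18 : (q : BiVincular) → q ∈ basePatterns → (w : List Sym) → (n : ℕ) → 3 ≤ n →
    NumAvoiders (applySyms w q) n (n ! ∸ ((n ∸ 1) ! / 2))
mainTheorem18 q q∈ w (suc (suc (suc m))) (s≤s (s≤s (s≤s z≤n))) =
  let (q₃ , q-count) = image-count m (All.lookup baseImages q∈) in symmetries-count w q q₃ q-count
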